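{- Let $\mathbf{x}\in\mathbb{Z}^{nt}$ be a feasible solution of the combinatorial $n$-fold IP, let $\alpha\in\mathbb{N}$, and let $\mathbf{h}$ be a solution of the augmentation graph $DP(\mathbf{x},\alpha)$. Then $\mathbf{l}\le\mathbf{x}+\alpha\mathbf{h}\le\mathbf{u}$ and $E^{(n)}\mathbf{h}=\mathbf{0}$.
   Context: Combinatorial $n$-fold IP: $\min\{f(\mathbf{x})\mid E^{(n)}\mathbf{x}=\mathbf{b},\ \mathbf{l}\le\mathbf{x}\le\mathbf{u},\ \mathbf{x}\in\mathbb{Z}^{nt}\}$, where $D\in\mathbb{Z}^{r\times t}$, $E^{(n)}$ has top rows $(D~\cdots~D)$ ($n$ copies) and below them the block-diagonal matrix with $n$ blocks $\mathbf{1}^{\intercal}=(1~\cdots~1)\in\mathbb{Z}^{1\times t}$, and $f(\mathbf{x})=\sum_{i,j}f^i_j(x^i_j)$ is separable convex; $\mathbf{x}$ is split into bricks $\mathbf{x}^1,\dots,\mathbf{x}^n\in\mathbb{Z}^t$, and $D_j$ denotes the $j$-th column of $D$. Let $\Delta=1+\|D\|_\infty$, let $g(E)=\max\{\|\mathbf{v}\|_1\mid\mathbf{v}\in\mathcal{G}(DG)\}$ where $G$ is the matrix whose columns are the Graver basis elements of $\mathbf{1}^{\intercal}$ (Graver basis: $\sqsubseteq$-minimal nonzero integer kernel elements, $\sqsubseteq$ the conformal order), and $\Sigma(E)=[-2\Delta g(E),2\Delta g(E)]^r\cap\mathbb{Z}^r$. The augmentation graph $DP(\mathbf{x},\alpha)$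 is a directed graph with source $S$, sink $T$ and layers $\mathcal{L}(i,j)=\{(i,j)\}\times[-g(E),g(E)]\times[-g(E),g(E)]\times\Sigma(E)$ for $i\in[n]$, $j\in[t]$ (integer intervals); vertex $(i,j,h^i_j,\beta^i_j,\boldsymbol{\sigma}^i_j)$ has weight $f^i_j(x^i_j+\alpha h^i_j)-f^i_j(x^i_j)$. Edges: (a) within a brick, for $j<t$, from $(i,j,h^i_j,\beta^i_j,\boldsymbol{\sigma}^i_j)$ to $(i,j+1,h^i_{j+1},\beta^i_{j+1},\boldsymbol{\sigma}^i_{j+1})$ whenever $l^i_{j+1}\le x^i_{j+1}+\alpha h^i_{j+1}\le u^i_{j+1}$, $\beta^i_{j+1}=\beta^i_j+h^i_{j+1}$ and $\boldsymbol{\sigma}^i_{j+1}=\boldsymbol{\sigma}^i_j+D_{j+1}h^i_{j+1}$; (b) between bricks, from each $(i,t,h^i_t,0,\boldsymbol{\sigma}^i_t)$ (only those with $\beta=0$) to each $(i+1,1,h^{i+1}_1,h^{i+1}_1,\boldsymbol{\sigma}^{i+1}_1)$ with $l^{i+1}_1\le x^{i+1}_1+\alpha h^{i+1}_1\le u^{i+1}_1$ and $\boldsymbol{\sigma}^{i+1}_1=\boldsymbol{\sigma}^i_t+D_1h^{i+1}_1$; here $S=(0,t,0,0,\mathbf{0})$ plays the role of the last vertex of a brick $0$, and $T=(n+1,1,0,0,\mathbf{0})$, so that $T$ is entered exactly from vertices $(n,t,h,0,\mathbf{0})$. A vector $\mathbf{h}\in\mathbb{Z}^{nt}$ is a solution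 of $DP(\mathbf{x},\alpha)$ if it is formed by the $h^i_j$-coordinates of the vertices of some $S$–$T$ path. -}

module Defs where

open import Data.Nat as ℕ using (ℕ; zero; suc; _⊔_)
open import Data.Integer as ℤ using (ℤ; +_; -_; _+_; _*_; _≤_; ∣_∣; 0ℤ; 1ℤ)
open import Data.Fin using (Fin; toℕ)
open import Data.Product using (Σ; ∃; _×_; _,_)
open import Data.Sum using (_⊎_)
open import Data.List using (List; []; _∷_)
open import Data.List.Membership.Propositional using (_∈_)
open import Relation.Binary.PropositionalEquality using (_≡_; _≢_)
open import Relation.Binary.Construct.Closure.ReflexiveTransitive using (Star; ε; _◅_)

sumℤ : ∀ {m} → (Fin m → ℤ) → ℤ
sumℤ {zero}  f = 0ℤ
sumℤ {suc m} f = f Data.Fin.zero + sumℤ (λ k → f (Data.Fin.suc k))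

sumℕ : ∀ {m} → (Fin m → ℕ) → ℕ
sumℕ {zero}  f = 0
sumℕ {suc m} f = f Data.Fin.zero ℕ.+ sumℕ (λ k → f (Data.Fin.suc k))

maxℕ : ∀ {m} → (Fin m → ℕ) → ℕ
maxℕ {zero}  f = 0
maxℕ {suc m} f = f Data.Fin.zero ⊔ maxℕ (λ k → f (Data.Fin.suc k))

Matrix : ℕ → ℕ → Set
Matrix p q = Fin p → Fin q → ℤ

_·_ : ∀ {p q} → Matrix p q → (Fin q → ℤ) → Fin p → ℤ
(A · v) k = sumℤ (λ j → A k j * v j)

InKernel : ∀ {p q} → Matrix p q → (Fin q → ℤ) → Set
InKernel A v = ∀ k → (A · v) k ≡ 0ℤ

NonZero : ∀ {q} → (Fin q → ℤ) → Set
NonZero v = ∃ λ j → v j ≢ 0ℤ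

_⊑_ : ∀ {q} → (Fin q → ℤ) → (Fin q → ℤ) → Set
u ⊑ v = ∀ j → (0ℤ ≤ u j * v j) × (∣ u j ∣ ℕ.≤ ∣ v j ∣)

IsGraver : ∀ {p q} → Matrix p q → (Fin q → ℤ) → Set
IsGraver A v =
  NonZero v × InKernel A v ×
  (∀ w → NonZero w → InKernel A w → w ⊑ v → ∀ j → w j ≡ v j)

norm1 : ∀ {q} → (Fin q → ℤ) → ℕ
norm1 v = sumℕ (λ j → ∣ v j ∣)

ones : (t : ℕ) → Matrix 1 t
ones t _ _ = 1ℤ

-- G : Fin k → (Fin t → ℤ) lists the columns of a matrix whose columns are
-- exactly the Graver basis elements of 1ᵀ, each once.
IsGraverMatrixOfOnes : (t k : ℕ) → (Fin k → Fin t → ℤ) → Set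
IsGraverMatrixOfOnes t k G =
  (∀ c → IsGraver (ones t) (G c)) ×
  (∀ v → IsGraver (ones t) v → ∃ λ c → ∀ j → G c j ≡ v j) ×
  (∀ c c' → (∀ j → G c j ≡ G c' j) → c ≡ c')

DG : ∀ {r t k} → Matrix r t → (Fin k → Fin t → ℤ) → Matrix r k
DG D G i c = sumℤ (λ j → D i j * G c j)

-- g is the maximum ℓ₁-norm of an element of the Graver basis of M
-- (0 if the Graver basis is empty)
IsMaxGraverNorm : ∀ {p q} → Matrix p q → ℕ → Set
IsMaxGraverNorm M g =
  (∀ v → IsGraver M v → norm1 v ℕ.≤ g) ×
  (g ≡ 0 ⊎ ∃ λ v → IsGraver M v × norm1 v ≡ g)

IsgE : ∀ {r t} → Matrix r t → ℕ → Set
IsgE {r} {t} D g =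
  Σ ℕ λ k → Σ (Fin k → Fin t → ℤ) λ G →
    IsGraverMatrixOfOnes t k G × IsMaxGraverNorm (DG D G) g

normInf : ∀ {r t} → Matrix r t → ℕ
normInf D = maxℕ (λ i → maxℕ (λ j → ∣ D i j ∣))

Δ : ∀ {r t} → Matrix r t → ℕ
Δ D = suc (normInf D)

-- Vectors in ℤ^{nt} are given brick-wise as
-- Fin n → Fin t → ℤ (x i j = x^i_j). Rows of E^{(n)} are indexed by
-- Fin r ⊎ Fin n (the r rows of (D ⋯ D), then the n rows of the block 1ᵀ's).

Bricks : ℕ → ℕ → Set
Bricks n t = Fin n → Fin t → ℤ

Emul : ∀ {n r t} → Matrix r t → Bricks n t → (Fin r ⊎ Fin n) → ℤ
Emul D h (Data.Sum.inj₁ k) = sumℤ (λ i → sumℤ (λ j → D k j * h i j))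
Emul D h (Data.Sum.inj₂ i) = sumℤ (λ j → h i j)

Between : ∀ {n t} → Bricks n t → Bricks n t → Bricks n t → Set
Between l y u = ∀ i j → (l i j ≤ y i j) × (y i j ≤ u i j)

Feasible : ∀ {n r t} → Matrix r t → (Fin r ⊎ Fin n → ℤ) →
           (l u x : Bricks n t) → Set
Feasible D b l u x = (∀ k → Emul D x k ≡ b k) × Between l x u

_+[_]_ : ∀ {n t} → Bricks n t → ℕ → Bricks n t → Bricks n t
(x +[ α ] h) i j = x i j + (+ α) * h i j

-- vertices: S, T, and (i, j, h, β, σ) (i, j are 0-based here)
data Vertex (n t r : ℕ) : Set where
  S T  : Vertex n t r
  node : Fin n → Fin t → (h β : ℤ) → (σ : Fin r → ℤ) → Vertex n t r

InBox : ℕ → ℤ → Set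
InBox a z = (- (+ a) ≤ z) × (z ≤ + a)

InLayer : ∀ {r} → (g Δ' : ℕ) → ℤ → ℤ → (Fin r → ℤ) → Set
InLayer g Δ' h β σ =
  InBox g h × InBox g β × (∀ k → InBox (2 ℕ.* Δ' ℕ.* g) (σ k))

module AugGraph {n t r : ℕ} (D : Matrix r t) (g : ℕ)
                (l u x : Bricks n t) (α : ℕ) where

  Lay : ℤ → ℤ → (Fin r → ℤ) → Set
  Lay = InLayer g (Δ D)

  Bnd : Fin n → Fin t → ℤ → Set
  Bnd i j h = (l i j ≤ x i j + (+ α) * h) × (x i j + (+ α) * h ≤ u i j)

  data Edge : Vertex n t r → Vertex n t r → Set where
    within : ∀ {i j j' h β σ h' β' σ'} →
      toℕ j' ≡ suc (toℕ j) →
      Lay h β σ → Lay h' β' σ' →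
      Bnd i j' h' →
      β' ≡ β + h' →
      (∀ k → σ' k ≡ σ k + D k j' * h') →
      Edge (node i j h β σ) (node i j' h' β' σ')
    between : ∀ {i i' jt j1 h σ h' σ'} →
      toℕ i' ≡ suc (toℕ i) → suc (toℕ jt) ≡ t → toℕ j1 ≡ 0 →
      Lay h 0ℤ σ → Lay h' h' σ' →
      Bnd i' j1 h' →
      (∀ k → σ' k ≡ σ k + D k j1 * h') →
      Edge (node i jt h 0ℤ σ) (node i' j1 h' h' σ')
    -- (b) from S = (0, t, 0, 0, 0) to the first vertex of brick 1
    fromS : ∀ {i' j1 h' σ'} →
      toℕ i' ≡ 0 → toℕ j1 ≡ 0 →
      Lay h' h' σ' →
      Bnd i' j1 h' →
      (∀ k → σ' k ≡ 0ℤ + D k j1 * h') →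
      Edge S (node i' j1 h' h' σ')
    -- (b) into T = (n+1, 1, 0, 0, 0), entered exactly from (n, t, h, 0, 0)
    toT : ∀ {i jt h} →
      suc (toℕ i) ≡ n → suc (toℕ jt) ≡ t →
      Lay h 0ℤ (λ _ → 0ℤ) →
      Edge (node i jt h 0ℤ (λ _ → 0ℤ)) T
    -- (b) degenerate case n = 0: S itself is the last vertex of brick n = 0
    STdirect : n ≡ 0 → Edge S T

  Path : Vertex n t r → Vertex n t r → Set
  Path = Star Edge

  vertices : ∀ {a b} → Path a b → List (Vertex n t r)
  vertices {a} ε        = a ∷ []
  vertices {a} (e ◅ p)  = a ∷ vertices p

  IsSolution : Bricks n t → Set
  IsSolution h = ∃ λ (p : Path S T) →
    ∀ i j → ∃ λ β → ∃ λ σ → node i j (h i j) β σ ∈ vertices p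

-- An S–T path visits the layers in lexicographic order of (i, j), and no layer twice, so
-- the h-coordinates on the path are exactly h. Along the path the edge conditions make β
-- the running sum of the current brick of h and σ the running value of (D ⋯ D) on the
-- visited prefix of h. A brick can only be left with β = 0, so every brick of h sums to
-- zero, and T can only be entered with σ = 0, so (D ⋯ D) h = 0. The bounds are the edge
-- conditions at the visited vertices.
module Submission where

open import Defs
open import Data.Nat using (ℕ; zero; suc; _<_; z<s)
import Data.Nat.Properties as ℕ
open import Data.Integer using (ℤ; 0ℤ; _+_; _*_)
import Data.Integer.Properties as ℤ
open import Data.Fin using (Fin; toℕ) renaming (zero to fzero; suc to fsuc)
open import Data.Fin.Properties using (toℕ<n; toℕ-injective)
open import Data.Product using (_×_; _,_)
open import Data.Product.Relation.Binary.Lex.Strict using (×-Lex; ×-transitive; ×-irreflexive)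
open import Data.Sum using (_⊎_; inj₁; inj₂)
open import Data.Empty using (⊥-elim)
open import Data.Unit using (⊤; tt)
open import Relation.Nullary using (¬_)
open import Data.List.Relation.Unary.Any using (here; there)
open import Data.List.Membership.Propositional using (_∈_)
open import Function using (_∘_)
open import Relation.Binary.PropositionalEquality
  using (_≡_; refl; sym; trans; cong; cong₂; subst; isEquivalence; module ≡-Reasoning)
open import Relation.Binary.Construct.Closure.ReflexiveTransitive using (ε; _◅_)

sumFirst : ∀ {m} → ℕ → (Fin m → ℤ) → ℤ
sumFirst {zero}  _       _ = 0ℤ
sumFirst {suc m} zero    _ = 0ℤ
sumFirst {suc m} (suc K) f = f fzero + sumFirst K (f ∘ fsuc)

sumFirst-zero : ∀ {m} (f : Fin m → ℤ) → sumFirst 0 f ≡ 0ℤ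
sumFirst-zero {zero}  _ = refl
sumFirst-zero {suc m} _ = refl

sumFirst-suc : ∀ {m} (f : Fin m → ℤ) (j : Fin m) →
               sumFirst (suc (toℕ j)) f ≡ sumFirst (toℕ j) f + f j
sumFirst-suc f fzero =
  trans (cong (f fzero +_) (sumFirst-zero (f ∘ fsuc))) (ℤ.+-comm (f fzero) 0ℤ)
sumFirst-suc f (fsuc j) =
  trans (cong (f fzero +_) (sumFirst-suc (f ∘ fsuc) j))
        (sym (ℤ.+-assoc (f fzero) _ (f (fsuc j))))

sumFirst-step : ∀ {m K} (f : Fin m → ℤ) (j : Fin m) → toℕ j ≡ K →
                sumFirst (suc (toℕ j)) f ≡ sumFirst K f + f j
sumFirst-step f j refl = sumFirst-suc f j

sumFirst-first : ∀ {m} (f : Fin m → ℤ) (j : Fin m) → toℕ j ≡ 0 →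
                 sumFirst (suc (toℕ j)) f ≡ f j
sumFirst-first f j j≡0 =
  trans (sumFirst-step f j j≡0) (trans (cong (_+ f j) (sumFirst-zero f)) (ℤ.+-identityˡ (f j)))

sumFirst-all : ∀ {m} (f : Fin m → ℤ) → sumFirst m f ≡ sumℤ f
sumFirst-all {zero}  _ = refl
sumFirst-all {suc m} f = cong (f fzero +_) (sumFirst-all (f ∘ fsuc))

module Visits {n t r : ℕ} (D : Matrix r t) (g : ℕ) (l u x : Bricks n t) (α : ℕ) where
  open AugGraph D g l u x α

  -- S sits before brick 1 and T after brick n, as in the paper's numbering.
  position : Vertex n t r → ℕ × ℕ
  position S                = 0 , 0
  position T                = suc n , 0
  position (node i j _ _ _) = suc (toℕ i) , toℕ j

  -- A record rather than a synonym, so that the endpoints can be inferred.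
  record _⊏_ (v w : Vertex n t r) : Set where
    constructor lex
    field unlex : ×-Lex _≡_ _<_ _<_ (position v) (position w)

  ⊏-trans : ∀ {v w z} → v ⊏ w → w ⊏ z → v ⊏ z
  ⊏-trans (lex v<w) (lex w<z) =
    lex (×-transitive {_≈₁_ = _≡_} {_<₂_ = _<_} isEquivalence ℕ.<-resp₂-≡ ℕ.<-trans ℕ.<-trans
                      v<w w<z)

  ⊏-irrefl : ∀ {i j a β σ a' β' σ'} → ¬ (node i j a β σ ⊏ node i j a' β' σ')
  ⊏-irrefl (lex v<w) =
    ×-irreflexive {_≈₁_ = _≡_} {_<₁_ = _<_} {_≈₂_ = _≡_} {_<₂_ = _<_}
      ℕ.<-irrefl ℕ.<-irrefl (refl , refl) v<w

  edge-⊏ : ∀ {v w} → Edge v w → v ⊏ w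
  edge-⊏ (within {j = j} j'≡1+j _ _ _ _ _) =
    lex (inj₂ (refl , subst (toℕ j <_) (sym j'≡1+j) (ℕ.n<1+n (toℕ j))))
  edge-⊏ (between {i = i} i'≡1+i _ _ _ _ _ _) =
    lex (inj₁ (subst (λ m → suc (toℕ i) < suc m) (sym i'≡1+i) (ℕ.n<1+n (suc (toℕ i)))))
  edge-⊏ (fromS _ _ _ _ _) = lex (inj₁ z<s)
  edge-⊏ (toT {i = i} 1+i≡n _ _) =
    lex (inj₁ (subst (λ m → suc (toℕ i) < suc m) 1+i≡n (ℕ.n<1+n (suc (toℕ i)))))
  edge-⊏ (STdirect _) = lex (inj₁ z<s)

  first-visited : ∀ {v w} (p : Path v w) → v ∈ vertices p
  first-visited ε       = here refl
  first-visited (_ ◅ _) = here refl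

  visits-after : ∀ {v w z} → Edge v w → (p : Path w z) → ∀ {y} → y ∈ vertices p → v ⊏ y
  visits-after e ε        (here refl) = edge-⊏ e
  visits-after e (_ ◅ _)  (here refl) = edge-⊏ e
  visits-after e (e' ◅ p) (there y∈p) = ⊏-trans (edge-⊏ e) (visits-after e' p y∈p)

  layer-visited-once : ∀ {v w} (p : Path v w) {i j a β σ a' β' σ'} →
    node i j a β σ ∈ vertices p → node i j a' β' σ' ∈ vertices p → a ≡ a'
  layer-visited-once ε       (here refl) (here refl) = refl
  layer-visited-once (e ◅ p) (here refl) (here refl) = refl
  layer-visited-once (e ◅ p) (here refl) (there y∈p) = ⊥-elim (⊏-irrefl (visits-after e p y∈p))
  layer-visited-once (e ◅ p) (there y∈p) (here refl) = ⊥-elim (⊏-irrefl (visits-after e p y∈p))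
  layer-visited-once (e ◅ p) (there y∈p) (there y'∈p) = layer-visited-once p y∈p y'∈p

  InBounds : Vertex n t r → Set
  InBounds (node i j a _ _) = Bnd i j a
  InBounds _                = ⊤

  edge-target-in-bounds : ∀ {v w} → Edge v w → InBounds w
  edge-target-in-bounds (within _ _ _ bnd _ _)    = bnd
  edge-target-in-bounds (between _ _ _ _ _ bnd _) = bnd
  edge-target-in-bounds (fromS _ _ _ bnd _)       = bnd
  edge-target-in-bounds (toT _ _ _)               = tt
  edge-target-in-bounds (STdirect _)              = tt

  visited-in-bounds : ∀ {w} (p : Path S w) {y} → y ∈ vertices p → InBounds y
  visited-in-bounds p = go tt p
    where
    go : ∀ {v w} → InBounds v → (p : Path v w) → ∀ {y} → y ∈ vertices p → InBounds y
    go bv ε       (here refl) = bv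
    go bv (_ ◅ _) (here refl) = bv
    go _  (e ◅ p) (there y∈p) = go (edge-target-in-bounds e) p y∈p

module Balance {n t r : ℕ} (D : Matrix r t) (g : ℕ) (l u x : Bricks n t) (α : ℕ) (h : Bricks n t) where
  open AugGraph D g l u x α
  open Visits D g l u x α using (first-visited)

  brickD : Fin r → Fin n → ℤ
  brickD k i = sumℤ (λ j → D k j * h i j)

  record AfterBricks (m : ℕ) (σ : Fin r → ℤ) : Set where
    field
      balanced : ∀ i → toℕ i < m → Emul D h (inj₂ i) ≡ 0ℤ
      σ-after  : ∀ k → σ k ≡ sumFirst m (brickD k)

  record AtLayer (i : Fin n) (j : Fin t) (β : ℤ) (σ : Fin r → ℤ) : Set where
    field
      balanced : ∀ i' → toℕ i' < toℕ i → Emul D h (inj₂ i') ≡ 0ℤ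
      β-at     : β ≡ sumFirst (suc (toℕ j)) (h i)
      σ-at     : ∀ k → σ k ≡ sumFirst (toℕ i) (brickD k)
                             + sumFirst (suc (toℕ j)) (λ j' → D k j' * h i j')

  start : AfterBricks 0 (λ _ → 0ℤ)
  start = record { balanced = λ _ () ; σ-after = λ k → sym (sumFirst-zero (brickD k)) }

  enter : ∀ {i j σ σ'} → AfterBricks (toℕ i) σ → toℕ j ≡ 0 →
          (∀ k → σ' k ≡ σ k + D k j * h i j) → AtLayer i j (h i j) σ'
  enter {i} {j} after j≡0 eσ = record
    { balanced = balanced
    ; β-at     = sym (sumFirst-first (h i) j j≡0)
    ; σ-at     = λ k → trans (eσ k)
        (cong₂ _+_ (σ-after k) (sym (sumFirst-first (λ j' → D k j' * h i j') j j≡0)))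
    }
    where open AfterBricks after

  advance : ∀ {i j j' β β' σ σ'} → AtLayer i j β σ → toℕ j' ≡ suc (toℕ j) →
            β' ≡ β + h i j' → (∀ k → σ' k ≡ σ k + D k j' * h i j') → AtLayer i j' β' σ'
  advance {i} {j} {j'} {σ = σ} {σ' = σ'} at j'≡1+j eβ eσ = record
    { balanced = balanced
    ; β-at     = trans eβ (trans (cong (_+ h i j') β-at) (sym (sumFirst-step (h i) j' j'≡1+j)))
    ; σ-at     = σ'-at
    }
    where
    open AtLayer at
    σ'-at : ∀ k → σ' k ≡ sumFirst (toℕ i) (brickD k)
                         + sumFirst (suc (toℕ j')) (λ j'' → D k j'' * h i j'')
    σ'-at k = begin
      σ' k                                        ≡⟨ eσ k ⟩
      σ k + D k j' * h i j'                       ≡⟨ cong (_+ D k j' * h i j') (σ-at k) ⟩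
      (P + Q) + D k j' * h i j'                   ≡⟨ ℤ.+-assoc P Q _ ⟩
      P + (Q + D k j' * h i j')                   ≡⟨ cong (P +_) (sym (sumFirst-step row j' j'≡1+j)) ⟩
      P + sumFirst (suc (toℕ j')) row             ∎
      where
      open ≡-Reasoning
      row = λ j'' → D k j'' * h i j''
      P = sumFirst (toℕ i) (brickD k)
      Q = sumFirst (suc (toℕ j)) row

  close : ∀ {i j σ} → AtLayer i j 0ℤ σ → suc (toℕ j) ≡ t → AfterBricks (suc (toℕ i)) σ
  close {i} {j} {σ} at 1+j≡t = record { balanced = balanced' ; σ-after = σ-after' }
    where
    open AtLayer at
    whole : ∀ (f : Fin t → ℤ) → sumFirst (suc (toℕ j)) f ≡ sumℤ f
    whole f = trans (cong (λ K → sumFirst K f) 1+j≡t) (sumFirst-all f)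

    balanced' : ∀ i' → toℕ i' < suc (toℕ i) → Emul D h (inj₂ i') ≡ 0ℤ
    balanced' i' i'<1+i with ℕ.m<1+n⇒m<n∨m≡n i'<1+i
    ... | inj₁ i'<i = balanced i' i'<i
    ... | inj₂ i'≡i rewrite toℕ-injective i'≡i = trans (sym (whole (h i))) (sym β-at)

    σ-after' : ∀ k → σ k ≡ sumFirst (suc (toℕ i)) (brickD k)
    σ-after' k = trans (σ-at k)
      (trans (cong (sumFirst (toℕ i) (brickD k) +_) (whole (λ j' → D k j' * h i j')))
             (sym (sumFirst-suc (brickD k) i)))

  finish : AfterBricks n (λ _ → 0ℤ) → ∀ k → Emul D h k ≡ 0ℤ
  finish after (inj₁ k) = sym (trans (σ-after k) (sumFirst-all (brickD k)))
    where open AfterBricks after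
  finish after (inj₂ i) = balanced i (toℕ<n i)
    where open AfterBricks after

  Invariant : Vertex n t r → Set
  Invariant S                = AfterBricks 0 (λ _ → 0ℤ)
  Invariant T                = ∀ k → Emul D h k ≡ 0ℤ
  Invariant (node i j _ β σ) = AtLayer i j β σ

  Agrees : Vertex n t r → Set
  Agrees (node i j a _ _) = a ≡ h i j
  Agrees _                = ⊤

  step : ∀ {v w} → Edge v w → Agrees w → Invariant v → Invariant w
  step (within j'≡1+j _ _ _ eβ eσ) refl at = advance at j'≡1+j eβ eσ
  step (between {σ = σ} i'≡1+i 1+j≡t j1≡0 _ _ _ eσ) refl at =
    enter (subst (λ m → AfterBricks m σ) (sym i'≡1+i) (close at 1+j≡t)) j1≡0 eσ
  step (fromS i'≡0 j1≡0 _ _ eσ) refl after =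
    enter (subst (λ m → AfterBricks m (λ _ → 0ℤ)) (sym i'≡0) after) j1≡0 eσ
  step (toT 1+i≡n 1+j≡t _) _ at =
    finish (subst (λ m → AfterBricks m (λ _ → 0ℤ)) 1+i≡n (close at 1+j≡t))
  step (STdirect n≡0) _ after = finish (subst (λ m → AfterBricks m (λ _ → 0ℤ)) (sym n≡0) after)

  propagate : ∀ {v} (p : Path v T) → (∀ {y} → y ∈ vertices p → Agrees y) → Invariant v → Invariant T
  propagate ε       _     inv = inv
  propagate (e ◅ p) agree inv = propagate p (agree ∘ there) (step e (agree (there (first-visited p))) inv)

lemma5 : (n t r : ℕ) (D : Matrix r t) (b : Fin r ⊎ Fin n → ℤ)
         (l u x : Bricks n t) (α g : ℕ) → IsgE D g →
         Feasible D b l u x →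
         (h : Bricks n t) → AugGraph.IsSolution D g l u x α h →
         Between l (x +[ α ] h) u × (∀ k → Emul D h k ≡ 0ℤ)
lemma5 n t r D b l u x α g _ _ h (p , visits) = in-bounds , propagate p agrees start
  where
  open AugGraph D g l u x α using (vertices)
  open Visits D g l u x α
  open Balance D g l u x α h

  in-bounds : Between l (x +[ α ] h) u
  in-bounds i j with visits i j
  ... | _ , _ , y∈p = visited-in-bounds p y∈p

  agrees : ∀ {y} → y ∈ vertices p → Agrees y
  agrees {node i j _ _ _} y∈p with visits i j
  ... | _ , _ , y'∈p = layer-visited-once p y∈p y'∈p
  agrees {S} _ = tt
  agrees {T} _ = tt
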